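{- Let $\mathbf{pf}$ be the ordinary paperfolding word. For every integer $n\ge 2$, neither $(2^{n-1}+2,\,2^{n-1}-2)$ nor $(2^{n-1}-2,\,2^{n-1}+2)$ belongs to $\psi(\mathcal{L}_{2^n,\mathbf{pf}})$.
   Context: The ordinary paperfolding word $\mathbf{pf}=(f_n)_{n\ge1}$ over $\{0,1\}$: write $n=m\cdot 2^j$ with $m$ odd; then $f_n=0$ if $m\equiv1\pmod 4$ and $f_n=1$ if $m\equiv3\pmod4$. $\mathcal{L}_{N,\mathbf{pf}}$ denotes the set of factors of length $N$ of $\mathbf{pf}$, and for a word $u$ over $\{0,1\}$, $\psi(u)=(|u|_0,|u|_1)$ is its Parikh vector ($|u|_c$ = number of occurrences of the letter $c$ in $u$); $\psi(\mathcal{L}_{N,\mathbf{pf}})=\{\psi(u):u\in\mathcal{L}_{N,\mathbf{pf}}\}$. -}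

module Defs where

open import Data.Nat using (ℕ; zero; suc; _+_; _*_; _≤_; _%_)
open import Data.Nat.Properties using (_≟_)
open import Data.Bool using (Bool; true; false; if_then_else_)
open import Data.List using (List; []; _∷_; map; length; filter)
open import Data.Product using (_×_; _,_; ∃-syntax)
open import Relation.Binary.PropositionalEquality using (_≡_)
open import Relation.Nullary.Decidable using (⌊_⌋)

data Letter : Set where
  𝟎 𝟏 : Letter

-- Auxiliary: the letter determined by the odd part of m, computed with
-- fuel k (k ≥ m suffices).  Strips factors of 2 from m, then looks at m mod 4.
pfAux : ℕ → ℕ → Letter
pfAux zero    m = 𝟎
pfAux (suc k) zero = 𝟎
pfAux (suc k) (suc m) with (suc m) % 2
... | zero  = pfAux k (Data.Nat._/_ (suc m) 2)
... | suc _ = if ⌊ (suc m) % 4 ≟ 1 ⌋ then 𝟎 else 𝟏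

-- The ordinary paperfolding word, indexed from 1:
-- for n = m·2^j with m odd, pf n = 0 if m ≡ 1 (mod 4) and 1 if m ≡ 3 (mod 4).
-- (The value at index 0 is irrelevant and never used.)
pf : ℕ → Letter
pf n = pfAux n n

factorAt : ℕ → ℕ → List Letter
factorAt i zero    = []
factorAt i (suc N) = pf i ∷ factorAt (suc i) N

InLang : ℕ → List Letter → Set
InLang N u = ∃[ i ] (1 ≤ i × u ≡ factorAt i N)

count : Letter → List Letter → ℕ
count c [] = 0
count 𝟎 (𝟎 ∷ u) = suc (count 𝟎 u)
count 𝟎 (𝟏 ∷ u) = count 𝟎 u
count 𝟏 (𝟎 ∷ u) = count 𝟏 u
count 𝟏 (𝟏 ∷ u) = suc (count 𝟏 u)

ψ : List Letter → ℕ × ℕ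
ψ u = (count 𝟎 u , count 𝟏 u)

InParikhSet : ℕ → ℕ × ℕ → Set
InParikhSet N v = ∃[ u ] (InLang N u × ψ u ≡ v)

module Submission where

-- Every factor of the paperfolding word whose length is a power of two
-- (at least 2) is balanced: its numbers of 0s and of 1s differ by at most 2.
-- The two Parikh vectors of the theorem differ by 4, so they cannot occur.
--
-- Balance is proved by induction on the length, using the self-similarity
-- of pf.  A factor of length 4M splits into its letters at even positions
-- and those at odd positions.  Since pf(2m) = pf(m), the even positions
-- spell a factor of pf of length 2M, balanced by induction; since
-- pf(4j+1) = 0 and pf(4j+3) = 1, consecutive odd positions carry opposite
-- letters, so the 2M odd-position letters are M zeros and M ones.  Adding
-- the same amount to both counts preserves balance.

open import Defs
open import Data.Nat using (ℕ; _+_; _∸_; _^_; _≤_; zero; suc; _*_; _%_; _/_; z≤n; s≤s)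
open import Data.Product using (_×_; _,_; ∃; ∃₂; proj₁; proj₂)
open import Relation.Nullary using (¬_)
open import Data.Nat.Properties
  using (_≟_; ≤-refl; ≤-trans; ≤-pred; *-comm; +-assoc; +-comm; +-monoˡ-≤;
         +-commutativeSemigroup; m≤m+n; m∸n+n≡m; m+1+n≰m; ^-monoʳ-≤)
open import Data.Nat.DivMod using ([m+kn]%n≡m%n; m*n%n≡0; m*n/n≡m; m/n<m)
open import Algebra.Properties.CommutativeSemigroup +-commutativeSemigroup
  using (interchange; xy∙z≈xz∙y)
open import Data.Sum using (_⊎_; inj₁; inj₂)
open import Data.List using (List; []; _∷_)
open import Data.Bool using (if_then_else_)
open import Relation.Nullary.Decidable using (⌊_⌋)
open import Relation.Binary.PropositionalEquality
  using (_≡_; refl; sym; trans; cong; cong₂; subst; subst₂; module ≡-Reasoning)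

-- `double m = 2m`, defined so that `double (suc m)` unfolds to two `suc`s;
-- this makes "two positions further on" a definitional step.
double : ℕ → ℕ
double zero    = zero
double (suc m) = suc (suc (double m))

double≡*2 : ∀ m → double m ≡ m * 2
double≡*2 zero    = refl
double≡*2 (suc m) = cong (λ x → suc (suc x)) (double≡*2 m)

double≡2* : ∀ m → double m ≡ 2 * m
double≡2* m = trans (double≡*2 m) (*-comm m 2)

double-double≡*4 : ∀ j → double (double j) ≡ j * 4
double-double≡*4 zero    = refl
double-double≡*4 (suc j) = cong (λ x → suc (suc (suc (suc x)))) (double-double≡*4 j)

even-or-odd : ∀ k → (∃ λ j → k ≡ double j) ⊎ (∃ λ j → k ≡ suc (double j))
even-or-odd zero = inj₁ (0 , refl)
even-or-odd (suc k) with even-or-odd k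
... | inj₁ (j , refl) = inj₂ (j , refl)
... | inj₂ (j , refl) = inj₁ (suc j , refl)

oddLetter : ℕ → Letter
oddLetter r = if ⌊ r ≟ 1 ⌋ then 𝟎 else 𝟏

pfAux-even : ∀ k m → suc m % 2 ≡ 0 → pfAux (suc k) (suc m) ≡ pfAux k (suc m / 2)
pfAux-even k m eq with suc m % 2
... | zero = refl
... | suc _ with () ← eq

pfAux-odd : ∀ k m → suc m % 2 ≡ 1 → pfAux (suc k) (suc m) ≡ oddLetter (suc m % 4)
pfAux-odd k m eq with suc m % 2
... | zero with () ← eq
... | suc _ = refl

pfAux-fuel : ∀ k k′ m → m ≤ k → m ≤ k′ → pfAux k m ≡ pfAux k′ m
pfAux-fuel zero    zero     zero    _       _       = refl
pfAux-fuel zero    (suc k′) zero    _       _       = refl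
pfAux-fuel (suc k) zero     zero    _       _       = refl
pfAux-fuel (suc k) (suc k′) zero    _       _       = refl
pfAux-fuel (suc k) (suc k′) (suc m) (s≤s m≤k) (s≤s m≤k′) with suc m % 2
... | zero  = pfAux-fuel k k′ (suc m / 2) (≤-trans half≤m m≤k) (≤-trans half≤m m≤k′)
  where
  half≤m : suc m / 2 ≤ m
  half≤m = ≤-pred (m/n<m (suc m) 2 (s≤s (s≤s z≤n)))
... | suc _ = refl

pf-double : ∀ j → pf (double (suc j)) ≡ pf (suc j)
pf-double j = begin
  pf (double (suc j))                  ≡⟨ pfAux-even (suc (double j)) (suc (double j)) even ⟩
  pfAux (suc (double j)) (m2 / 2)      ≡⟨ cong (pfAux (suc (double j))) halve ⟩
  pfAux (suc (double j)) (suc j)       ≡⟨ pfAux-fuel (suc (double j)) (suc j) (suc j) 1+j≤1+2j ≤-refl ⟩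
  pf (suc j)                           ∎
  where
  open ≡-Reasoning
  m2 = double (suc j)
  even : m2 % 2 ≡ 0
  even = trans (cong (_% 2) (double≡*2 (suc j))) (m*n%n≡0 (suc j) 2)
  halve : m2 / 2 ≡ suc j
  halve = trans (cong (_/ 2) (double≡*2 (suc j))) (m*n/n≡m (suc j) 2)
  1+j≤1+2j : suc j ≤ suc (double j)
  1+j≤1+2j = s≤s (subst (j ≤_) (sym (double≡2* j)) (m≤m+n j (j + 0)))

pf-odd : ∀ j → pf (suc (double j)) ≡ oddLetter (suc (double j) % 4)
pf-odd j = pfAux-odd (double j) (double j) odd
  where
  odd : suc (double j) % 2 ≡ 1
  odd = trans (cong (λ x → suc x % 2) (double≡*2 j)) ([m+kn]%n≡m%n 1 j 2)

pf-4j+1 : ∀ j → pf (suc (double (double j))) ≡ 𝟎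
pf-4j+1 j = trans (pf-odd (double j)) (cong oddLetter residue)
  where
  residue : suc (double (double j)) % 4 ≡ 1
  residue = trans (cong (λ x → suc x % 4) (double-double≡*4 j)) ([m+kn]%n≡m%n 1 j 4)

pf-4j+3 : ∀ j → pf (suc (suc (suc (double (double j))))) ≡ 𝟏
pf-4j+3 j = trans (pf-odd (suc (double j))) (cong oddLetter residue)
  where
  residue : suc (suc (suc (double (double j)))) % 4 ≡ 3
  residue = trans (cong (λ x → suc (suc (suc x)) % 4) (double-double≡*4 j)) ([m+kn]%n≡m%n 3 j 4)

opposite : Letter → Letter
opposite 𝟎 = 𝟏
opposite 𝟏 = 𝟎

pf-odd-alternates : ∀ k → pf (suc (double (suc k))) ≡ opposite (pf (suc (double k)))
pf-odd-alternates k with even-or-odd k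
... | inj₁ (j , refl) = trans (pf-4j+3 j) (cong opposite (sym (pf-4j+1 j)))
... | inj₂ (j , refl) = trans (pf-4j+1 (suc j)) (cong opposite (sym (pf-4j+3 j)))

count-∷ : ∀ c x l → count c (x ∷ l) ≡ count c (x ∷ []) + count c l
count-∷ 𝟎 𝟎 l = refl
count-∷ 𝟎 𝟏 l = refl
count-∷ 𝟏 𝟎 l = refl
count-∷ 𝟏 𝟏 l = refl

count-opposite-pair : ∀ c {a b} l → b ≡ opposite a → count c (a ∷ b ∷ l) ≡ suc (count c l)
count-opposite-pair 𝟎 {𝟎} l refl = refl
count-opposite-pair 𝟎 {𝟏} l refl = refl
count-opposite-pair 𝟏 {𝟎} l refl = refl
count-opposite-pair 𝟏 {𝟏} l refl = refl

everyOther : ℕ → ℕ → List Letter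
everyOther i zero    = []
everyOther i (suc M) = pf i ∷ everyOther (suc (suc i)) M

count-deinterleave : ∀ c i M →
  count c (factorAt i (double M)) ≡ count c (everyOther i M) + count c (everyOther (suc i) M)
count-deinterleave c i zero    = refl
count-deinterleave c i (suc M) = begin
  count c (factorAt i (double (suc M)))
    ≡⟨ count-∷ c (pf i) _ ⟩
  x + count c (pf (suc i) ∷ factorAt (suc (suc i)) (double M))
    ≡⟨ cong (x +_) (count-∷ c (pf (suc i)) _) ⟩
  x + (y + count c (factorAt (suc (suc i)) (double M)))
    ≡⟨ cong (λ z → x + (y + z)) (count-deinterleave c (suc (suc i)) M) ⟩
  x + (y + (a + b))
    ≡⟨ sym (+-assoc x y (a + b)) ⟩
  (x + y) + (a + b)
    ≡⟨ interchange x y a b ⟩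
  (x + a) + (y + b)
    ≡⟨ sym (cong₂ _+_ (count-∷ c (pf i) _) (count-∷ c (pf (suc i)) _)) ⟩
  count c (everyOther i (suc M)) + count c (everyOther (suc i) (suc M))
    ∎
  where
  open ≡-Reasoning
  x = count c (pf i ∷ [])
  y = count c (pf (suc i) ∷ [])
  a = count c (everyOther (suc (suc i)) M)
  b = count c (everyOther (suc (suc (suc i))) M)

everyOther-even : ∀ j M → everyOther (double (suc j)) M ≡ factorAt (suc j) M
everyOther-even j zero    = refl
everyOther-even j (suc M) = cong₂ _∷_ (pf-double j) (everyOther-even (suc j) M)

everyOther-odd-balanced : ∀ k M →
  count 𝟎 (everyOther (suc (double k)) (double M)) ≡ count 𝟏 (everyOther (suc (double k)) (double M))
everyOther-odd-balanced k zero    = refl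
everyOther-odd-balanced k (suc M) = begin
  count 𝟎 (pf i ∷ pf (suc (suc i)) ∷ rest) ≡⟨ count-opposite-pair 𝟎 rest (pf-odd-alternates k) ⟩
  suc (count 𝟎 rest)                       ≡⟨ cong suc (everyOther-odd-balanced (suc (suc k)) M) ⟩
  suc (count 𝟏 rest)                       ≡⟨ sym (count-opposite-pair 𝟏 rest (pf-odd-alternates k)) ⟩
  count 𝟏 (pf i ∷ pf (suc (suc i)) ∷ rest) ∎
  where
  open ≡-Reasoning
  i = suc (double k)
  rest = everyOther (suc (double (suc (suc k)))) (double M)

factor-split : ∀ i → 1 ≤ i → ∃₂ λ j k → ∀ c M →
  count c (factorAt i (double M)) ≡ count c (factorAt (suc j) M) + count c (everyOther (suc (double k)) M)
factor-split i 1≤i with even-or-odd i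
... | inj₁ (zero , refl) with () ← 1≤i
... | inj₁ (suc j , refl) = j , suc j , λ c M →
  trans (count-deinterleave c (double (suc j)) M)
        (cong (λ w → count c w + count c (everyOther (suc (double (suc j))) M)) (everyOther-even j M))
... | inj₂ (j , refl) = j , j , λ c M →
  trans (count-deinterleave c (suc (double j)) M)
        (trans (+-comm (count c (everyOther (suc (double j)) M)) _)
               (cong (λ w → count c w + count c (everyOther (suc (double j)) M)) (everyOther-even j M)))

WithinTwo : ℕ → ℕ → Set
WithinTwo a b = a ≤ b + 2 × b ≤ a + 2

withinTwo-swap : ∀ {a b} → WithinTwo a b → WithinTwo b a
withinTwo-swap (p , q) = q , p

withinTwo-+ : ∀ {a b} x → WithinTwo a b → WithinTwo (a + x) (b + x)
withinTwo-+ {a} {b} x (p , q) = shift a b p , shift b a q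
  where
  shift : ∀ m n → m ≤ n + 2 → m + x ≤ n + x + 2
  shift m n m≤n+2 = subst (m + x ≤_) (xy∙z≈xz∙y n 2 x) (+-monoˡ-≤ x m≤n+2)

Balanced : ℕ → ℕ → Set
Balanced i N = WithinTwo (count 𝟎 (factorAt i N)) (count 𝟏 (factorAt i N))

balanced-two : ∀ i → Balanced i 2
balanced-two i with pf i | pf (suc i)
... | 𝟎 | 𝟎 = s≤s (s≤s z≤n) , z≤n
... | 𝟎 | 𝟏 = s≤s z≤n , s≤s z≤n
... | 𝟏 | 𝟎 = s≤s z≤n , s≤s z≤n
... | 𝟏 | 𝟏 = z≤n , s≤s (s≤s z≤n)

balanced-doubling : ∀ M → (∀ j → Balanced (suc j) (double M)) →
  ∀ i → 1 ≤ i → Balanced i (double (double M))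
balanced-doubling M balanced i 1≤i with factor-split i 1≤i
... | j , k , split =
  subst₂ WithinTwo (sym (split 𝟎 (double M))) (sym (split 𝟏 (double M)))
    (subst (λ o → WithinTwo (_ + count 𝟎 odds) (_ + o)) (everyOther-odd-balanced k M)
      (withinTwo-+ (count 𝟎 odds) (balanced j)))
  where
  odds = everyOther (suc (double k)) (double M)

double-pow : ∀ n → double (2 ^ n) ≡ 2 ^ suc n
double-pow n = double≡2* (2 ^ n)

balanced-powers : ∀ n i → 1 ≤ i → Balanced i (2 ^ suc n)
balanced-powers zero    i _   = balanced-two i
balanced-powers (suc n) i 1≤i =
  subst (Balanced i) (trans (cong double (double-pow n)) (double-pow (suc n)))
    (balanced-doubling (2 ^ n) previous i 1≤i)
  where
  previous : ∀ j → Balanced (suc j) (double (2 ^ n))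
  previous j = subst (Balanced (suc j)) (sym (double-pow n)) (balanced-powers n (suc j) (s≤s z≤n))

parikh-withinTwo : ∀ n {v} → InParikhSet (2 ^ suc n) v → WithinTwo (proj₁ v) (proj₂ v)
parikh-withinTwo n (_ , (i , 1≤i , refl) , refl) = balanced-powers n i 1≤i

far-apart : ∀ a → 2 ≤ a → ¬ WithinTwo (a + 2) (a ∸ 2)
far-apart a 2≤a (p , _) = m+1+n≰m a (subst (a + 2 ≤_) (m∸n+n≡m 2≤a) p)

lemma2 : (n : ℕ) → 2 ≤ n →
    ¬ InParikhSet (2 ^ n) (2 ^ (n ∸ 1) + 2 , 2 ^ (n ∸ 1) ∸ 2) ×
    ¬ InParikhSet (2 ^ n) (2 ^ (n ∸ 1) ∸ 2 , 2 ^ (n ∸ 1) + 2)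
lemma2 (suc zero)    (s≤s ())
lemma2 (suc (suc n)) _ =
  (λ v∈ → far (parikh-withinTwo (suc n) v∈)) ,
  (λ v∈ → far (withinTwo-swap (parikh-withinTwo (suc n) v∈)))
  where
  far : ¬ WithinTwo (2 ^ suc n + 2) (2 ^ suc n ∸ 2)
  far = far-apart (2 ^ suc n) (^-monoʳ-≤ 2 {1} {suc n} (s≤s z≤n))
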